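{- Suppose $\sigma$ occurs at least twice as a consecutive pattern in $\tau$ and that $|\tau|-|\sigma|\ge 3$. If the interior $\partial\tau\partial$ of $\tau$ does not lie in the interval $[\sigma,\tau]$, then $\mu(\sigma,\tau)=1$.
   Context: Permutations are of $[d]=\{1,\dots,d\}$; $|\pi|$ is the length of $\pi$. The standard form of a sequence of distinct integers is the permutation of $\{1,\dots,d\}$ order isomorphic to it. An occurrence of a consecutive pattern $\sigma$ in $\tau$ is a factor of consecutive letters of $\tau$ order isomorphic to $\sigma$. Permutations are partially ordered by $\sigma\le\tau$ iff $\sigma$ occurs as a consecutive pattern in $\tau$; $[\sigma,\tau]=\{\rho:\sigma\le\rho\le\tau\}$, and $\mu$ is the Möbius function of this poset ($\mu(x,x)=1$, $\mu(x,y)=-\sum_{x\le z<y}\mu(x,z)$ for $x<y$). The interior $\partial\tau\partial$ of $\tau$ is the standard form of $\tau$ with both its first and last letters removed. -}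

module Defs where

open import Data.Nat using (ℕ; zero; suc; _+_; _∸_; _<ᵇ_; _≤_)
open import Data.Nat.Properties using () renaming (_≟_ to _≟ℕ_)
open import Data.Bool using (Bool; true; false; if_then_else_)
open import Data.List using (List; []; _∷_; length; map; filter; take; drop; upTo; deduplicate; foldr; concatMap)
open import Data.List.Properties using (≡-dec)
open import Data.List.Relation.Binary.Permutation.Propositional using (_↭_)
open import Data.Integer using (ℤ; -_) renaming (+_ to ⁺_; _+_ to _+ℤ_)
open import Data.Product using (_×_)
open import Relation.Nullary using (¬_; Dec; yes; no; does; ¬?)
open import Relation.Nullary.Decidable using (_×-dec_)
import Data.Nat.Properties
open import Relation.Nullary.Decidable using (⌊_⌋)
open import Relation.Binary.PropositionalEquality using (_≡_)

range1 : ℕ → List ℕ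
range1 d = map suc (upTo d)

IsPerm : List ℕ → Set
IsPerm π = π ↭ range1 (length π)

st : List ℕ → List ℕ
st xs = map (λ x → suc (length (filter (λ y → y Data.Nat.<? x) xs))) xs

_≟L_ : (xs ys : List ℕ) → Dec (xs ≡ ys)
_≟L_ = ≡-dec _≟ℕ_

window : ℕ → ℕ → List ℕ → List ℕ
window i k τ = take k (drop i τ)

occurrences : List ℕ → List ℕ → List ℕ
occurrences σ τ =
  filter (λ i → st (window i (length σ) τ) ≟L σ)
         (upTo (suc (length τ) ∸ length σ))

occ : List ℕ → List ℕ → ℕ
occ σ τ = length (occurrences σ τ)

_≼_ : List ℕ → List ℕ → Set
σ ≼ τ = 1 ≤ occ σ τ

_≼?_ : (σ τ : List ℕ) → Dec (σ ≼ τ)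
σ ≼? τ = 1 Data.Nat.≤? occ σ τ

InInterval : List ℕ → List ℕ → List ℕ → Set
InInterval σ τ ρ = (σ ≼ ρ) × (ρ ≼ τ)

patterns : List ℕ → List (List ℕ)
patterns τ = deduplicate _≟L_
  (concatMap (λ k → map (λ i → st (window i k τ)) (upTo (suc (length τ) ∸ k)))
             (upTo (suc (length τ))))

sumℤ : List ℤ → ℤ
sumℤ = foldr _+ℤ_ (⁺ 0)

-- Möbius function with fuel: μ(σ,σ)=1, μ(σ,τ) = - Σ_{σ ≼ z, z ≼ τ, z ≠ τ} μ(σ,z) for σ ≼ τ, σ ≠ τ,
-- and 0 when σ ⋠ τ.  Any z ≼ τ with z ≠ τ is strictly shorter than τ.
μ′ : ℕ → List ℕ → List ℕ → ℤ
μ′ zero σ τ = ⁺ 0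
μ′ (suc f) σ τ with σ ≟L τ
... | yes _ = ⁺ 1
... | no _ with σ ≼? τ
...   | no _ = ⁺ 0
...   | yes _ = - sumℤ (map (μ′ f σ)
          (filter (λ z → (σ ≼? z) ×-dec ¬? (z ≟L τ)) (patterns τ)))

μ : List ℕ → List ℕ → ℤ
μ σ τ = μ′ (suc (length τ)) σ τ

interior : List ℕ → List ℕ
interior τ = st (take (length τ ∸ 2) (drop 1 τ))

module Submission where

-- Write k = |σ| and n = |τ|. An occurrence of σ away from both ends of τ would be an occurrence
-- in ∂τ∂, putting ∂τ∂ in [σ, τ]; so the two occurrences are at the start and at the end of τ, and
-- every element of [σ, τ] is the standard form of a prefix pⱼ or a suffix sⱼ of τ with j ≥ k.
-- Hence [σ, τ) = {σ} ∪ {pⱼ : k < j < n} ∪ {sⱼ : k < j < n}, and the two families are disjoint,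
-- since pⱼ = sⱼ would give an occurrence of σ at position j - k. Inside a family the lower
-- intervals are initial segments, [σ, pⱼ) = {σ, p₍ₖ₊₁₎, …, p₍ⱼ₋₁₎}, so μ(σ, p₍ₖ₊₁₎) = -1 and
-- μ(σ, pⱼ) = 0 for j > k + 1, and likewise for suffixes; thus μ(σ, τ) = -(1 - 1 - 1) = 1.

open import Defs
open import Data.Nat
  using (ℕ; zero; suc; _+_; _∸_; _⊓_; _≤_; _<_; z≤n; s≤s; z<s; s<s; _<?_; _≟_)
open import Data.Nat.Properties
open import Data.Integer using (ℤ; -_; -[1+_]) renaming (+_ to ⁺_; _+_ to _+ℤ_)
import Data.Integer.Properties as ℤ
open import Data.List
  using (List; []; _∷_; _++_; length; map; filter; take; drop; upTo; applyUpTo; concatMap)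
open import Data.List.Properties
  using (take-drop; take-take; drop-drop; drop-map; take-map; take-all; length-take; length-drop;
         length-map; map-∘; map-id; map-++; filter-++; filter-all; filter-reject;
         filter-≐; length-upTo; upTo-∷ʳ; ++-identityʳ)
open import Data.List.Membership.Propositional using (_∈_; find; lose)
open import Data.List.Membership.Propositional.Properties
  using (∈-map⁺; ∈-map⁻; ∈-filter⁺; ∈-filter⁻; ∈-upTo⁺; ∈-upTo⁻; ∈-applyUpTo⁺; ∈-applyUpTo⁻;
         ∈-++⁺ˡ; ∈-++⁺ʳ; ∈-++⁻; ∈-concatMap⁺; ∈-concatMap⁻; ∈-deduplicate⁺; ∈-deduplicate⁻)
open import Data.List.Relation.Unary.Any using (here; there)
open import Data.List.Relation.Unary.All using (_∷_; tabulate)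
import Data.List.Relation.Unary.All.Properties as All
open import Data.List.Relation.Unary.AllPairs using (_∷_)
open import Data.List.Relation.Unary.Unique.Propositional using (Unique)
import Data.List.Relation.Unary.Unique.Propositional.Properties as Unique
open import Data.List.Relation.Unary.Unique.DecPropositional.Properties using (deduplicate-!)
open import Data.List.Relation.Binary.Permutation.Propositional using (_↭_; ↭⇒↭ₛ)
open import Data.List.Relation.Binary.Permutation.Propositional.Properties
  using (∈-resp-↭; ↭-length; filter-↭; map⁺)
import Data.List.Relation.Binary.Permutation.Setoid.Properties as PermutationSetoid
open import Data.List.Membership.Propositional.Properties.WithK using (unique∧set⇒bag)
open import Data.List.Relation.Binary.BagAndSetEquality using (∼bag⇒↭)
open import Function.Bundles using (mk⇔)
open import Data.Product using (_×_; _,_; proj₁; proj₂; ∃; ∃₂; map₁)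
open import Data.Sum using (_⊎_; inj₁; inj₂)
open import Data.Empty using (⊥-elim)
open import Level using (0ℓ)
open import Function using (_∘_)
open import Relation.Nullary using (¬_; ¬?; yes; no)
open import Relation.Nullary.Decidable using (_×-dec_)
open import Relation.Unary using (Pred; Decidable)
open import Relation.Binary.PropositionalEquality
open ≡-Reasoning

window-window : ∀ (xs : List ℕ) a b i j → i + j ≤ b →
                window i j (window a b xs) ≡ window (a + i) j xs
window-window xs a b i j i+j≤b = begin
  take j (drop i (take b (drop a xs)))       ≡⟨ take-drop j i _ ⟩
  drop i (take (i + j) (take b (drop a xs))) ≡⟨ cong (drop i) (take-take (i + j) b _) ⟩
  drop i (take ((i + j) ⊓ b) (drop a xs))    ≡⟨ cong (λ l → drop i (take l (drop a xs))) (m≤n⇒m⊓n≡m i+j≤b) ⟩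
  drop i (take (i + j) (drop a xs))          ≡⟨ take-drop j i (drop a xs) ⟨
  take j (drop i (drop a xs))                ≡⟨ cong (take j) (drop-drop a i xs) ⟩
  take j (drop (a + i) xs)                   ∎

length-window : ∀ (xs : List ℕ) a j → a + j ≤ length xs → length (window a j xs) ≡ j
length-window xs a j a+j≤ = begin
  length (take j (drop a xs)) ≡⟨ length-take j (drop a xs) ⟩
  j ⊓ length (drop a xs)      ≡⟨ cong (j ⊓_) (length-drop a xs) ⟩
  j ⊓ (length xs ∸ a)         ≡⟨ m≤n⇒m⊓n≡m (m+n≤o⇒m≤o∸n j (subst (_≤ length xs) (+-comm a j) a+j≤)) ⟩
  j                           ∎

∈-window : ∀ {x} (xs : List ℕ) a j → x ∈ window a j xs → x ∈ xs
∈-window xs a j = ∈-drop a xs ∘ ∈-take j (drop a xs)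
  where
  ∈-take : ∀ {x} j (xs : List ℕ) → x ∈ take j xs → x ∈ xs
  ∈-take (suc j) (y ∷ xs) (here x≡y) = here x≡y
  ∈-take (suc j) (y ∷ xs) (there x∈) = there (∈-take j xs x∈)
  ∈-drop : ∀ {x} a (xs : List ℕ) → x ∈ drop a xs → x ∈ xs
  ∈-drop zero    xs       x∈ = x∈
  ∈-drop (suc a) (y ∷ xs) x∈ = there (∈-drop a xs x∈)

module _ {P Q : Pred ℕ 0ℓ} (P? : Decidable P) (Q? : Decidable Q) where

  length-filter-mono : ∀ xs → (∀ {y} → y ∈ xs → P y → Q y) →
                       length (filter P? xs) ≤ length (filter Q? xs)
  length-filter-mono []       P⇒Q = z≤n
  length-filter-mono (x ∷ xs) P⇒Q with P? x | Q? x
  ... | yes px | yes _  = s≤s (length-filter-mono xs (P⇒Q ∘ there))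
  ... | yes px | no ¬qx = ⊥-elim (¬qx (P⇒Q (here refl) px))
  ... | no _   | yes _  = m≤n⇒m≤1+n (length-filter-mono xs (P⇒Q ∘ there))
  ... | no _   | no _   = length-filter-mono xs (P⇒Q ∘ there)

  length-filter-mono-< : ∀ {x} xs → (∀ {y} → y ∈ xs → P y → Q y) → x ∈ xs → Q x → ¬ P x →
                         length (filter P? xs) < length (filter Q? xs)
  length-filter-mono-< (y ∷ xs) P⇒Q (here refl) qx ¬px with P? y | Q? y
  ... | yes py | _      = ⊥-elim (¬px py)
  ... | no _   | no ¬qy = ⊥-elim (¬qy qx)
  ... | no _   | yes _  = s≤s (length-filter-mono xs (P⇒Q ∘ there))
  length-filter-mono-< (y ∷ xs) P⇒Q (there x∈) qx ¬px with P? y | Q? y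
  ... | yes py | yes _  = s≤s (length-filter-mono-< xs (P⇒Q ∘ there) x∈ qx ¬px)
  ... | yes py | no ¬qy = ⊥-elim (¬qy (P⇒Q (here refl) py))
  ... | no _   | yes _  = m≤n⇒m≤1+n (length-filter-mono-< xs (P⇒Q ∘ there) x∈ qx ¬px)
  ... | no _   | no _   = length-filter-mono-< xs (P⇒Q ∘ there) x∈ qx ¬px

length-filter-map : ∀ {P : Pred ℕ 0ℓ} (P? : Decidable P) (g : ℕ → ℕ) xs →
                    length (filter P? (map g xs)) ≡ length (filter (P? ∘ g) xs)
length-filter-map P? g []       = refl
length-filter-map P? g (x ∷ xs) with P? (g x)
... | yes _ = cong suc (length-filter-map P? g xs)
... | no _  = length-filter-map P? g xs

map-cong-∈ : ∀ {A : Set} (f g : ℕ → A) xs → (∀ {x} → x ∈ xs → f x ≡ g x) → map f xs ≡ map g xs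
map-cong-∈ f g []       f≡g = refl
map-cong-∈ f g (x ∷ xs) f≡g = cong₂ _∷_ (f≡g (here refl)) (map-cong-∈ f g xs (f≡g ∘ there))

rank : ℕ → List ℕ → ℕ
rank x xs = length (filter (_<? x) xs)

rank-<-mono : ∀ {a b} xs → a ∈ xs → a < b → rank a xs < rank b xs
rank-<-mono xs a∈ a<b =
  length-filter-mono-< (_<? _) (_<? _) xs (λ _ y<a → <-trans y<a a<b) a∈ a<b (<-irrefl refl)

rank-≤-mono : ∀ {a b} xs → a ≤ b → rank a xs ≤ rank b xs
rank-≤-mono xs a≤b = length-filter-mono (_<? _) (_<? _) xs (λ _ y<a → <-≤-trans y<a a≤b)

st-relabel : ∀ (g : ℕ → ℕ) w →
             (∀ {a b} → a ∈ w → b ∈ w → a < b → g a < g b) →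
             (∀ {a b} → a ∈ w → b ∈ w → g a < g b → a < b) →
             st (map g w) ≡ st w
st-relabel g w preserves reflects = begin
  map (λ y → suc (rank y (map g w))) (map g w) ≡⟨ map-∘ w ⟨
  map (λ x → suc (rank (g x) (map g w))) w     ≡⟨ map-cong-∈ _ _ w (cong suc ∘ same-rank) ⟩
  map (λ x → suc (rank x w)) w                 ∎
  where
  same-rank : ∀ {x} → x ∈ w → rank (g x) (map g w) ≡ rank x w
  same-rank {x} x∈ = begin
    length (filter (_<? g x) (map g w))         ≡⟨ length-filter-map (_<? g x) g w ⟩
    length (filter (λ y → g y <? g x) w)        ≡⟨ ≤-antisym
        (length-filter-mono _ _ w (λ y∈ → reflects y∈ x∈))
        (length-filter-mono _ _ w (λ y∈ → preserves y∈ x∈)) ⟩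
    rank x w                                    ∎

-- Standardising a window of the standard form is standardising the window: the ranks in xs
-- are an order-isomorphic relabelling of the letters of xs.
st-window-st : ∀ i j xs → st (window i j (st xs)) ≡ st (window i j xs)
st-window-st i j xs = begin
  st (take j (drop i (map r xs))) ≡⟨ cong (st ∘ take j) (drop-map i xs) ⟩
  st (take j (map r (drop i xs))) ≡⟨ cong st (take-map j (drop i xs)) ⟩
  st (map r (window i j xs))      ≡⟨ st-relabel r (window i j xs) preserves reflects ⟩
  st (window i j xs)              ∎
  where
  r : ℕ → ℕ
  r x = suc (rank x xs)
  preserves : ∀ {a b} → a ∈ window i j xs → b ∈ window i j xs → a < b → r a < r b
  preserves a∈ _ a<b = s≤s (rank-<-mono xs (∈-window xs i j a∈) a<b)
  reflects : ∀ {a b} → a ∈ window i j xs → b ∈ window i j xs → r a < r b → a < b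
  reflects _ _ ra<rb = ≰⇒> (λ b≤a → <⇒≱ ra<rb (s≤s (rank-≤-mono xs b≤a)))

filter-<-upTo : ∀ {y} d → y ≤ d → filter (_<? y) (upTo d) ≡ upTo y
filter-<-upTo {y} zero    z≤n = refl
filter-<-upTo {y} (suc d) y≤1+d with m≤n⇒m<n∨m≡n y≤1+d
... | inj₂ refl = filter-all (_<? y) (tabulate ∈-upTo⁻)
... | inj₁ y<1+d = begin
  filter (_<? y) (upTo (suc d))                      ≡⟨ cong (filter (_<? y)) (upTo-∷ʳ d) ⟨
  filter (_<? y) (upTo d ++ d ∷ [])                  ≡⟨ filter-++ (_<? y) (upTo d) (d ∷ []) ⟩
  filter (_<? y) (upTo d) ++ filter (_<? y) (d ∷ []) ≡⟨ cong₂ _++_ (filter-<-upTo d (≤-pred y<1+d))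
                                                          (filter-reject (_<? y) (≤⇒≯ (≤-pred y<1+d))) ⟩
  upTo y ++ []                                       ≡⟨ ++-identityʳ (upTo y) ⟩
  upTo y                                             ∎

-- A permutation of [d] is its own standard form: the letter 1+i has exactly i smaller letters.
st-perm : ∀ π → IsPerm π → st π ≡ π
st-perm π π↭ = trans (map-cong-∈ _ _ π rank-in-perm) (map-id π)
  where
  d = length π
  rank-in-perm : ∀ {x} → x ∈ π → suc (rank x π) ≡ x
  rank-in-perm {x} x∈ with ∈-map⁻ suc (∈-resp-↭ π↭ x∈)
  ... | i , i∈ , refl = cong suc (begin
    rank (suc i) π                                  ≡⟨ ↭-length (filter-↭ (_<? suc i) π↭) ⟩
    length (filter (_<? suc i) (map suc (upTo d)))  ≡⟨ length-filter-map (_<? suc i) suc (upTo d) ⟩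
    length (filter (λ y → suc y <? suc i) (upTo d)) ≡⟨ cong length (filter-≐ _ _ (≤-pred , s≤s) (upTo d)) ⟩
    length (filter (_<? i) (upTo d))                ≡⟨ cong length (filter-<-upTo d (<⇒≤ (∈-upTo⁻ i∈))) ⟩
    length (upTo i)                                 ≡⟨ length-upTo i ⟩
    i                                               ∎)

Occ : List ℕ → List ℕ → ℕ → Set
Occ σ τ i = i + length σ ≤ length τ × st (window i (length σ) τ) ≡ σ

<-1+∸⇒+≤ : ∀ i k t → i < suc t ∸ k → i + k ≤ t
<-1+∸⇒+≤ i zero    t       i< = subst (_≤ t) (sym (+-identityʳ i)) (≤-pred i<)
<-1+∸⇒+≤ i (suc k) zero    i< = ⊥-elim (n≮0 (subst (i <_) (0∸n≡0 k) i<))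
<-1+∸⇒+≤ i (suc k) (suc t) i< = subst (_≤ suc t) (sym (+-suc i k)) (s≤s (<-1+∸⇒+≤ i k t i<))

+≤⇒<-1+∸ : ∀ i k t → i + k ≤ t → i < suc t ∸ k
+≤⇒<-1+∸ i zero    t       i+k≤ = s≤s (subst (_≤ t) (+-identityʳ i) i+k≤)
+≤⇒<-1+∸ i (suc k) zero    i+k≤ = ⊥-elim (n≮0 (subst (_≤ 0) (+-suc i k) i+k≤))
+≤⇒<-1+∸ i (suc k) (suc t) i+k≤ = +≤⇒<-1+∸ i k t (≤-pred (subst (_≤ suc t) (+-suc i k) i+k≤))

∈-occurrences⁻ : ∀ σ τ {i} → i ∈ occurrences σ τ → Occ σ τ i
∈-occurrences⁻ σ τ {i} i∈ with ∈-filter⁻ (λ i → st (window i (length σ) τ) ≟L σ) {xs = upTo _} i∈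
... | i∈upTo , st≡σ = <-1+∸⇒+≤ i (length σ) (length τ) (∈-upTo⁻ i∈upTo) , st≡σ

∈-occurrences⁺ : ∀ σ τ {i} → Occ σ τ i → i ∈ occurrences σ τ
∈-occurrences⁺ σ τ {i} (fits , st≡σ) =
  ∈-filter⁺ (λ i → st (window i (length σ) τ) ≟L σ) (∈-upTo⁺ (+≤⇒<-1+∸ i (length σ) (length τ) fits)) st≡σ

≼-intro : ∀ σ τ {i} → Occ σ τ i → σ ≼ τ
≼-intro σ τ o with occurrences σ τ | ∈-occurrences⁺ σ τ o
... | _ ∷ _ | _ = s≤s z≤n

≼-elim : ∀ σ τ → σ ≼ τ → ∃ (Occ σ τ)
≼-elim σ τ σ≼τ with occurrences σ τ | ∈-occurrences⁻ σ τ
... | i ∷ _ | occ⁻ = i , occ⁻ (here refl)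

two-distinct : ∀ {A : Set} {xs : List A} → Unique xs → 2 ≤ length xs →
               ∃₂ λ x y → x ∈ xs × y ∈ xs × x ≢ y
two-distinct {xs = x ∷ y ∷ _} ((x≢y ∷ _) ∷ _) _       = x , y , here refl , there (here refl) , x≢y
two-distinct {xs = _ ∷ []}    _                  (s≤s ())

occurrences-unique : ∀ σ τ → Unique (occurrences σ τ)
occurrences-unique σ τ =
  Unique.filter⁺ (λ i → st (window i (length σ) τ) ≟L σ) (Unique.upTo⁺ (suc (length τ) ∸ length σ))

two-occurrences : ∀ σ τ → 2 ≤ occ σ τ → ∃₂ λ i j → Occ σ τ i × Occ σ τ j × i ≢ j
two-occurrences σ τ 2≤occ
  with i , j , i∈ , j∈ , i≢j ← two-distinct (occurrences-unique σ τ) 2≤occ =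
  i , j , ∈-occurrences⁻ σ τ i∈ , ∈-occurrences⁻ σ τ j∈ , i≢j

IsFactor : List ℕ → List ℕ → Set
IsFactor z ρ = ∃₂ λ a j → a + j ≤ length ρ × z ≡ st (window a j ρ)

factors : List ℕ → ℕ → List (List ℕ)
factors ρ j = map (λ i → st (window i j ρ)) (upTo (suc (length ρ) ∸ j))

∈-patterns⁻ : ∀ ρ {z} → z ∈ patterns ρ → IsFactor z ρ
∈-patterns⁻ ρ z∈
  with j , j∈ , z∈ⱼ ←
         find (∈-concatMap⁻ (factors ρ) {xs = upTo (suc (length ρ))} (∈-deduplicate⁻ _≟L_ _ z∈))
  with a , a∈ , z≡ ← ∈-map⁻ (λ i → st (window i j ρ)) z∈ⱼ =
  a , j , <-1+∸⇒+≤ a j (length ρ) (∈-upTo⁻ a∈) , z≡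

∈-patterns⁺ : ∀ ρ a j → a + j ≤ length ρ → st (window a j ρ) ∈ patterns ρ
∈-patterns⁺ ρ a j fits = ∈-deduplicate⁺ _≟L_ (∈-concatMap⁺ (factors ρ)
  (lose (∈-upTo⁺ (s≤s (m+n≤o⇒n≤o a fits)))
        (∈-map⁺ (λ i → st (window i j ρ)) (∈-upTo⁺ (+≤⇒<-1+∸ a j (length ρ) fits)))))

sumℤ-↭ : ∀ {xs ys : List ℤ} → xs ↭ ys → sumℤ xs ≡ sumℤ ys
sumℤ-↭ xs↭ys = PermutationSetoid.foldr-commMonoid (setoid ℤ) ℤ.+-0-isCommutativeMonoid (↭⇒↭ₛ xs↭ys)

sum-same-members : ∀ {A : Set} (g : A → ℤ) {xs ys : List A} → Unique xs → Unique ys →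
                   (∀ {z} → z ∈ xs → z ∈ ys) → (∀ {z} → z ∈ ys → z ∈ xs) →
                   sumℤ (map g xs) ≡ sumℤ (map g ys)
sum-same-members g xs! ys! xs⊆ys ys⊆xs =
  sumℤ-↭ (map⁺ g (∼bag⇒↭ (unique∧set⇒bag xs! ys! (mk⇔ xs⊆ys ys⊆xs))))

sumℤ-++ : ∀ xs ys → sumℤ (xs ++ ys) ≡ sumℤ xs +ℤ sumℤ ys
sumℤ-++ []       ys = sym (ℤ.+-identityˡ (sumℤ ys))
sumℤ-++ (x ∷ xs) ys = trans (cong (x +ℤ_) (sumℤ-++ xs ys)) (sym (ℤ.+-assoc x (sumℤ xs) (sumℤ ys)))

below : List ℕ → List ℕ → List (List ℕ)
below σ ρ = filter (λ z → (σ ≼? z) ×-dec ¬? (z ≟L ρ)) (patterns ρ)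

below-unique : ∀ σ ρ → Unique (below σ ρ)
below-unique σ ρ = Unique.filter⁺ (λ z → (σ ≼? z) ×-dec ¬? (z ≟L ρ))
  (deduplicate-! _≟L_ (concatMap (factors ρ) (upTo (suc (length ρ)))))

∈-below⁻ : ∀ σ ρ {z} → z ∈ below σ ρ → IsFactor z ρ × σ ≼ z × z ≢ ρ
∈-below⁻ σ ρ z∈ with ∈-filter⁻ (λ z → (σ ≼? z) ×-dec ¬? (z ≟L ρ)) {xs = patterns ρ} z∈
... | z∈patterns , σ≼z , z≢ρ = ∈-patterns⁻ ρ z∈patterns , σ≼z , z≢ρ

∈-below⁺ : ∀ σ ρ {z} → z ∈ patterns ρ → σ ≼ z → z ≢ ρ → z ∈ below σ ρ
∈-below⁺ σ ρ z∈ σ≼z z≢ρ = ∈-filter⁺ (λ z → (σ ≼? z) ×-dec ¬? (z ≟L ρ)) z∈ (σ≼z , z≢ρ)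

μ′-refl : ∀ {f} σ → 0 < f → μ′ f σ σ ≡ ⁺ 1
μ′-refl {suc f} σ _ with σ ≟L σ
... | yes _   = refl
... | no σ≢σ = ⊥-elim (σ≢σ refl)

μ′-recurrence : ∀ f σ ρ (T : List (List ℕ)) → σ ≢ ρ → σ ≼ ρ → Unique T →
                (∀ {z} → z ∈ below σ ρ → z ∈ T) → (∀ {z} → z ∈ T → z ∈ below σ ρ) →
                μ′ (suc f) σ ρ ≡ - sumℤ (map (μ′ f σ) T)
μ′-recurrence f σ ρ T σ≢ρ σ≼ρ T! below⊆T T⊆below with σ ≟L ρ
... | yes σ≡ρ = ⊥-elim (σ≢ρ σ≡ρ)
... | no _ with σ ≼? ρ
...   | no σ⋠ρ = ⊥-elim (σ⋠ρ σ≼ρ)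
...   | yes _  = cong -_ (sum-same-members (μ′ f σ) (below-unique σ ρ) T! below⊆T T⊆below)

-- The Möbius values along a chain σ < c 0 < c 1 < …, and their partial sums.
chainValue : ℕ → ℤ
chainValue zero    = -[1+ 0 ]
chainValue (suc _) = ⁺ 0

chainSum : ℕ → ℤ
chainSum zero    = ⁺ 0
chainSum (suc _) = -[1+ 0 ]

sum-chainValues : ∀ (g : List ℕ → ℤ) (c : ℕ → List ℕ) i →
                  (∀ {j} → j < i → g (c j) ≡ chainValue j) →
                  sumℤ (map g (applyUpTo c i)) ≡ chainSum i
sum-chainValues g c zero    _      = refl
sum-chainValues g c (suc i) values =
  cong₂ _+ℤ_ (values z<s) (sum-zero (c ∘ suc) i (values ∘ s<s))
  where
  sum-zero : ∀ c i → (∀ {j} → j < i → g (c j) ≡ ⁺ 0) → sumℤ (map g (applyUpTo c i)) ≡ ⁺ 0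
  sum-zero c zero    _     = refl
  sum-zero c (suc i) zeros = cong₂ _+ℤ_ (zeros z<s) (sum-zero (c ∘ suc) i (zeros ∘ s<s))

≢-by-length : ∀ {x y : List ℕ} → length x ≢ length y → x ≢ y
≢-by-length |x|≢|y| x≡y = |x|≢|y| (cong length x≡y)

chain-unique : ∀ σ (c : ℕ → List ℕ) i → (∀ {j} → j < i → length (c j) ≡ suc (length σ) + j) →
               Unique (σ ∷ applyUpTo c i)
chain-unique σ c i length-c =
  All.applyUpTo⁺₁ c i (λ j<i → ≢-by-length (λ eq → m≢1+m+n (length σ) (trans eq (length-c j<i))))
  ∷ Unique.applyUpTo⁺₁ c i (λ j<j′ j′<i → ≢-by-length (λ eq →
      <⇒≢ (+-monoʳ-< (suc (length σ)) j<j′)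
          (trans (sym (length-c (<-trans j<j′ j′<i))) (trans eq (length-c j′<i)))))

module Chain (σ : List ℕ) (c : ℕ → List ℕ) (N : ℕ)
  (length-c : ∀ {i} → i < N → length (c i) ≡ suc (length σ) + i)
  (σ≼c : ∀ {i} → i < N → σ ≼ c i)
  (below⊆ : ∀ {i z} → i < N → z ∈ below σ (c i) → z ∈ σ ∷ applyUpTo c i)
  (below⊇ : ∀ {i z} → i < N → z ∈ σ ∷ applyUpTo c i → z ∈ below σ (c i))
  where

  μ-chain : ∀ f {i} → i < N → suc (length σ) + i < f → μ′ f σ (c i) ≡ chainValue i
  μ-chain (suc f) {i} i<N fuel = begin
    μ′ (suc f) σ (c i)
      ≡⟨ μ′-recurrence f σ (c i) (σ ∷ applyUpTo c i) σ≢cᵢ (σ≼c i<N)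
           (chain-unique σ c i (λ j<i → length-c (<-trans j<i i<N))) (below⊆ i<N) (below⊇ i<N) ⟩
    - (μ′ f σ σ +ℤ sumℤ (map (μ′ f σ) (applyUpTo c i)))
      ≡⟨ cong₂ (λ a b → - (a +ℤ b)) (μ′-refl σ (<-≤-trans z<s (≤-pred fuel)))
           (sum-chainValues (μ′ f σ) c i (λ j<i →
             μ-chain f (<-trans j<i i<N) (<-≤-trans (+-monoʳ-< (suc (length σ)) j<i) (≤-pred fuel)))) ⟩
    - (⁺ 1 +ℤ chainSum i)
      ≡⟨ negate i ⟩
    chainValue i ∎
    where
    σ≢cᵢ : σ ≢ c i
    σ≢cᵢ = ≢-by-length (λ eq → m≢1+m+n (length σ) (trans eq (length-c i<N)))
    negate : ∀ i → - (⁺ 1 +ℤ chainSum i) ≡ chainValue i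
    negate zero    = refl
    negate (suc _) = refl

m+n≡o⇒m≡o∸n : ∀ {m} n {o} → m + n ≡ o → m ≡ o ∸ n
m+n≡o⇒m≡o∸n {m} n m+n≡o = trans (sym (m+n∸n≡m m n)) (cong (_∸ n) m+n≡o)

module Ends (σ τ : List ℕ) (3+k≤n : 3 + length σ ≤ length τ)
            (∂τ∂∉ : ¬ InInterval σ τ (interior τ)) where

  k n : ℕ
  k = length σ
  n = length τ

  k<n : k < n
  k<n = ≤-trans (s≤s (m≤n+m k 2)) 3+k≤n

  W : ℕ → ℕ → List ℕ
  W a j = st (window a j τ)

  length-W : ∀ {a j} → a + j ≤ n → length (W a j) ≡ j
  length-W {a} {j} fits = trans (length-map _ (window a j τ)) (length-window τ a j fits)

  W-window : ∀ b m a j → a + j ≤ m → st (window a j (W b m)) ≡ W (b + a) j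
  W-window b m a j fits = trans (st-window-st a j (window b m τ)) (cong st (window-window τ b m a j fits))

  -- An occurrence of σ away from both ends of τ lies inside ∂τ∂ = W 1 (n - 2),
  -- which would put ∂τ∂ in [σ, τ].
  occurrence-at-end : ∀ {i} → Occ σ τ i → i ≡ 0 ⊎ i + k ≡ n
  occurrence-at-end {zero}  _ = inj₁ refl
  occurrence-at-end {suc i} (fits , st≡σ) with suc i + k ≟ n
  ... | yes at-end = inj₂ at-end
  ... | no ¬at-end = ⊥-elim (∂τ∂∉ (≼-intro σ (interior τ) σ-in-∂τ∂ , interior≼τ))
    where
    1+[n-2]≤n : 1 + (n ∸ 2) ≤ n
    1+[n-2]≤n = subst (1 + (n ∸ 2) ≤_) (m+[n∸m]≡n (≤-trans (m≤m+n 2 (suc k)) 3+k≤n)) (n≤1+n _)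
    length-∂τ∂ : length (interior τ) ≡ n ∸ 2
    length-∂τ∂ = length-W 1+[n-2]≤n
    interior≼τ : interior τ ≼ τ
    interior≼τ = ≼-intro (interior τ) τ
      (subst (λ l → 1 + l ≤ n) (sym length-∂τ∂) 1+[n-2]≤n , cong (λ l → W 1 l) length-∂τ∂)
    inside : i + k ≤ n ∸ 2
    inside = m+n≤o⇒m≤o∸n (i + k) (subst (_≤ n) (+-comm 2 (i + k)) (≤∧≢⇒< fits ¬at-end))
    σ-in-∂τ∂ : Occ σ (interior τ) i
    σ-in-∂τ∂ = subst (i + k ≤_) (sym length-∂τ∂) inside , trans (W-window 1 (n ∸ 2) i k inside) st≡σ

  factor-at-end : ∀ {b j} → b + j ≤ n → σ ≼ W b j → (b ≡ 0 ⊎ b + j ≡ n) × k ≤ j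
  factor-at-end {b} {j} fits σ≼W with ≼-elim σ (W b j) σ≼W
  ... | i , i+k≤ , st≡σ = at-end (occurrence-at-end {b + i} (b+i+k≤n , σ-at-b+i)) , k≤j
    where
    i+k≤j : i + k ≤ j
    i+k≤j = subst (i + k ≤_) (length-W fits) i+k≤
    k≤j : k ≤ j
    k≤j = m+n≤o⇒n≤o i i+k≤j
    b+i+k≤b+j : b + i + k ≤ b + j
    b+i+k≤b+j = subst (_≤ b + j) (sym (+-assoc b i k)) (+-monoʳ-≤ b i+k≤j)
    b+i+k≤n : b + i + k ≤ n
    b+i+k≤n = ≤-trans b+i+k≤b+j fits
    σ-at-b+i : W (b + i) k ≡ σ
    σ-at-b+i = trans (sym (W-window b j i k i+k≤j)) st≡σ
    at-end : b + i ≡ 0 ⊎ b + i + k ≡ n → b ≡ 0 ⊎ b + j ≡ n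
    at-end (inj₁ b+i≡0)   = inj₁ (m+n≡0⇒m≡0 b b+i≡0)
    at-end (inj₂ b+i+k≡n) = inj₂ (≤-antisym fits (subst (_≤ b + j) b+i+k≡n b+i+k≤b+j))

  both-ends : ∀ {i j} → Occ σ τ i → Occ σ τ j → i ≢ j → Occ σ τ 0 × Occ σ τ (n ∸ k)
  both-ends {i} {j} oᵢ oⱼ i≢j with occurrence-at-end oᵢ | occurrence-at-end oⱼ
  ... | inj₁ refl   | inj₁ refl   = ⊥-elim (i≢j refl)
  ... | inj₁ refl   | inj₂ j+k≡n  = oᵢ , subst (Occ σ τ) (m+n≡o⇒m≡o∸n k j+k≡n) oⱼ
  ... | inj₂ i+k≡n  | inj₁ refl   = oⱼ , subst (Occ σ τ) (m+n≡o⇒m≡o∸n k i+k≡n) oᵢ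
  ... | inj₂ i+k≡n  | inj₂ j+k≡n  = ⊥-elim (i≢j (+-cancelʳ-≡ k i j (trans i+k≡n (sym j+k≡n))))

  module AtBothEnds (st-τ : st τ ≡ τ) (σ-at-start : Occ σ τ 0) (σ-at-end : Occ σ τ (n ∸ k)) where

    data End : Set where
      prefix suffix : End

    start : End → ℕ → ℕ
    start prefix j = 0
    start suffix j = n ∸ j

    end : End → ℕ → List ℕ
    end d j = W (start d j) j

    start-fits : ∀ d {j} → j ≤ n → start d j + j ≤ n
    start-fits prefix j≤n = j≤n
    start-fits suffix j≤n = ≤-reflexive (m∸n+n≡m j≤n)

    length-end : ∀ d {j} → j ≤ n → length (end d j) ≡ j
    length-end d j≤n = length-W (start-fits d j≤n)

    end-k : ∀ d → end d k ≡ σ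
    end-k prefix = proj₂ σ-at-start
    end-k suffix = proj₂ σ-at-end

    end-n : ∀ d → end d n ≡ τ
    end-n prefix = trans (cong st (take-all n τ ≤-refl)) st-τ
    end-n suffix = trans (cong (λ a → W a n) (n∸n≡0 n)) (end-n prefix)

    offset : End → ℕ → ℕ → ℕ
    offset prefix m j = 0
    offset suffix m j = m ∸ j

    offset-fits : ∀ d {m j} → j ≤ m → offset d m j + j ≤ m
    offset-fits prefix j≤m = j≤m
    offset-fits suffix j≤m = ≤-reflexive (m∸n+n≡m j≤m)

    end-in-end : ∀ d {m j} → j ≤ m → m ≤ n → st (window (offset d m j) j (end d m)) ≡ end d j
    end-in-end d {m} {j} j≤m m≤n =
      trans (W-window (start d m) m (offset d m j) j (offset-fits d j≤m))
            (cong (λ a → W a j) (start+offset d))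
      where
      start+offset : ∀ d → start d m + offset d m j ≡ start d j
      start+offset prefix = refl
      start+offset suffix = trans (sym (+-∸-assoc (n ∸ m) j≤m)) (cong (_∸ j) (m∸n+n≡m m≤n))

    σ≼end : ∀ d {j} → k ≤ j → j ≤ n → σ ≼ end d j
    σ≼end d {j} k≤j j≤n = ≼-intro σ (end d j)
      (subst (offset d j k + k ≤_) (sym (length-end d j≤n)) (offset-fits d k≤j) ,
       trans (end-in-end d k≤j j≤n) (end-k d))

    end-in-below : ∀ d {j m} → k ≤ j → j < m → m ≤ n → end d j ∈ below σ (end d m)
    end-in-below d {j} {m} k≤j j<m m≤n = ∈-below⁺ σ (end d m)
      (subst (_∈ patterns (end d m)) (end-in-end d (<⇒≤ j<m) m≤n)
        (∈-patterns⁺ (end d m) (offset d m j) j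
          (subst (offset d m j + j ≤_) (sym (length-end d m≤n)) (offset-fits d (<⇒≤ j<m)))))
      (σ≼end d k≤j (<⇒≤ (<-≤-trans j<m m≤n)))
      (≢-by-length (λ eq → <⇒≢ j<m (trans (sym (length-end d j≤n)) (trans eq (length-end d m≤n)))))
      where
      j≤n : j ≤ n
      j≤n = <⇒≤ (<-≤-trans j<m m≤n)

    factor-is-end : ∀ {a j} → a + j ≤ n → σ ≼ W a j → (∃ λ d → a ≡ start d j) × k ≤ j
    factor-is-end {a} {j} fits σ≼W = map₁ at-an-end (factor-at-end fits σ≼W)
      where
      at-an-end : a ≡ 0 ⊎ a + j ≡ n → ∃ λ d → a ≡ start d j
      at-an-end (inj₁ a≡0)   = prefix , a≡0
      at-an-end (inj₂ a+j≡n) = suffix , m+n≡o⇒m≡o∸n j a+j≡n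

    start-in-end : ∀ d {m a j} → m < n → a + j ≤ m → σ ≼ W (start d m + a) j →
                   start d m + a ≡ start d j × k ≤ j
    start-in-end d {m} {a} {j} m<n a+j≤m σ≼W =
      same-side d (proj₁ (factor-at-end b+j≤n σ≼W)) , proj₂ (factor-at-end b+j≤n σ≼W)
      where
      b+j≤n : start d m + a + j ≤ n
      b+j≤n = ≤-trans (≤-reflexive (+-assoc (start d m) a j))
                (≤-trans (+-monoʳ-≤ (start d m) a+j≤m) (start-fits d (<⇒≤ m<n)))
      same-side : ∀ d → start d m + a ≡ 0 ⊎ start d m + a + j ≡ n → start d m + a ≡ start d j
      same-side prefix (inj₁ a≡0)     = a≡0
      same-side prefix (inj₂ a+j≡n)   = ⊥-elim (<⇒≱ m<n (subst (_≤ m) a+j≡n a+j≤m))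
      same-side suffix (inj₁ n-m+a≡0) = ⊥-elim (<⇒≱ m<n (m∸n≡0⇒m≤n (m+n≡0⇒m≡0 (n ∸ m) n-m+a≡0)))
      same-side suffix (inj₂ b+j≡n)   = m+n≡o⇒m≡o∸n j b+j≡n

    factor-of-end : ∀ d {m a j} → m < n → a + j ≤ m → σ ≼ st (window a j (end d m)) →
                    st (window a j (end d m)) ≡ end d j × k ≤ j
    factor-of-end d {m} {a} {j} m<n a+j≤m σ≼z =
      trans z≡W (cong (λ b → W b j) (proj₁ position)) , proj₂ position
      where
      z≡W : st (window a j (end d m)) ≡ W (start d m + a) j
      z≡W = W-window (start d m) m a j a+j≤m
      position = start-in-end d m<n a+j≤m (subst (σ ≼_) z≡W σ≼z)

    chain : End → ℕ → List ℕ
    chain d i = end d (suc k + i)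

    N : ℕ
    N = n ∸ suc k

    chain-proper : ∀ {i} → i < N → suc k + i < n
    chain-proper {i} i<N = subst (suc k + i <_) (m+[n∸m]≡n k<n) (+-monoʳ-< (suc k) i<N)

    length-chain : ∀ d {i} → i < N → length (chain d i) ≡ suc k + i
    length-chain d i<N = length-end d (<⇒≤ (chain-proper i<N))

    end-in-chain : ∀ d {i j} → k ≤ j → j < suc k + i → end d j ∈ σ ∷ applyUpTo (chain d) i
    end-in-chain d {i} {j} k≤j j<1+k+i with m≤n⇒m<n∨m≡n k≤j
    ... | inj₂ refl = here (end-k d)
    ... | inj₁ k<j  = there (subst (_∈ applyUpTo (chain d) i) (cong (end d) 1+k+[j-1-k]≡j)
                                   (∈-applyUpTo⁺ (chain d) j-1-k<i))
      where
      1+k+[j-1-k]≡j : suc k + (j ∸ suc k) ≡ j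
      1+k+[j-1-k]≡j = m+[n∸m]≡n k<j
      j-1-k<i : j ∸ suc k < i
      j-1-k<i = +-cancelˡ-< (suc k) _ _ (subst (_< suc k + i) (sym 1+k+[j-1-k]≡j) j<1+k+i)

    below-chain⊆ : ∀ d {i z} → i < N → z ∈ below σ (chain d i) → z ∈ σ ∷ applyUpTo (chain d) i
    below-chain⊆ d {i} {z} i<N z∈ = classify (∈-below⁻ σ (chain d i) z∈)
      where
      classify : IsFactor z (chain d i) × σ ≼ z × z ≢ chain d i → z ∈ σ ∷ applyUpTo (chain d) i
      classify ((a , j , fits , z≡factor) , σ≼z , z≢chain) =
        subst (_∈ _) (sym z≡end) (end-in-chain d (proj₂ above) j<1+k+i)
        where
        a+j≤1+k+i : a + j ≤ suc k + i
        a+j≤1+k+i = subst (a + j ≤_) (length-chain d i<N) fits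
        above = factor-of-end d (chain-proper i<N) a+j≤1+k+i (subst (σ ≼_) z≡factor σ≼z)
        z≡end : z ≡ end d j
        z≡end = trans z≡factor (proj₁ above)
        j<1+k+i : j < suc k + i
        j<1+k+i = ≤∧≢⇒< (m+n≤o⇒n≤o a a+j≤1+k+i) (λ j≡ → z≢chain (trans z≡end (cong (end d) j≡)))

    below-chain⊇ : ∀ d {i z} → i < N → z ∈ σ ∷ applyUpTo (chain d) i → z ∈ below σ (chain d i)
    below-chain⊇ d {i} i<N (here refl) = subst (_∈ below σ (chain d i)) (end-k d)
      (end-in-below d ≤-refl (s≤s (m≤m+n k i)) (<⇒≤ (chain-proper i<N)))
    below-chain⊇ d {i} i<N (there z∈) with ∈-applyUpTo⁻ (chain d) z∈
    ... | i′ , i′<i , refl =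
      end-in-below d (m≤n⇒m≤1+n (m≤m+n k i′)) (+-monoʳ-< (suc k) i′<i) (<⇒≤ (chain-proper i<N))

    module ChainAt (d : End) =
      Chain σ (chain d) N (length-chain d)
            (λ {i} i<N → σ≼end d (m≤n⇒m≤1+n (m≤m+n k i)) (<⇒≤ (chain-proper i<N)))
            (below-chain⊆ d) (below-chain⊇ d)

    -- A prefix and a suffix of the same proper length m > k differ: otherwise the occurrence
    -- of σ at the end of the suffix would be an occurrence in τ at position m - k.
    prefix≢suffix : ∀ {m} → k < m → m < n → end prefix m ≢ end suffix m
    prefix≢suffix {m} k<m m<n prefix≡suffix with occurrence-at-end {m ∸ k} σ-at-m-k
      where
      σ-at-m-k : Occ σ τ (m ∸ k)
      σ-at-m-k = ≤-trans (≤-reflexive (m∸n+n≡m (<⇒≤ k<m))) (<⇒≤ m<n) ,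
        (begin
          W (m ∸ k) k
            ≡⟨ W-window 0 m (m ∸ k) k (offset-fits suffix (<⇒≤ k<m)) ⟨
          st (window (m ∸ k) k (end prefix m))
            ≡⟨ cong (st ∘ window (m ∸ k) k) prefix≡suffix ⟩
          st (window (offset suffix m k) k (end suffix m))
            ≡⟨ end-in-end suffix (<⇒≤ k<m) (<⇒≤ m<n) ⟩
          end suffix k
            ≡⟨ end-k suffix ⟩
          σ ∎)
    ... | inj₁ m-k≡0   = <⇒≱ k<m (m∸n≡0⇒m≤n m-k≡0)
    ... | inj₂ m-k+k≡n = <⇒≢ m<n (trans (sym (m∸n+n≡m (<⇒≤ k<m))) m-k+k≡n)

    prefixes suffixes : List (List ℕ)
    prefixes = applyUpTo (chain prefix) N
    suffixes = applyUpTo (chain suffix) N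

    interval : List (List ℕ)
    interval = σ ∷ (prefixes ++ suffixes)

    interval-unique : Unique interval
    interval-unique with chain-unique σ (chain prefix) N (length-chain prefix)
                       | chain-unique σ (chain suffix) N (length-chain suffix)
    ... | σ∉prefixes ∷ prefixes! | σ∉suffixes ∷ suffixes! =
      All.++⁺ σ∉prefixes σ∉suffixes ∷ Unique.++⁺ prefixes! suffixes! disjoint
      where
      disjoint : ∀ {v} → ¬ (v ∈ prefixes × v ∈ suffixes)
      disjoint (v∈p , v∈s) with ∈-applyUpTo⁻ (chain prefix) v∈p | ∈-applyUpTo⁻ (chain suffix) v∈s
      ... | i , i<N , refl | i′ , i′<N , p≡s
        with refl ← +-cancelˡ-≡ (suc k) i i′
              (trans (sym (length-chain prefix i<N)) (trans (cong length p≡s) (length-chain suffix i′<N)))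
        = prefix≢suffix (s≤s (m≤m+n k i)) (chain-proper i<N) p≡s

    end-in-interval : ∀ d {j} → k ≤ j → j < n → end d j ∈ interval
    end-in-interval d {j} k≤j j<n
      with end-in-chain d {N} k≤j (subst (j <_) (sym (m+[n∸m]≡n k<n)) j<n)
    ... | here e = here e
    end-in-interval prefix k≤j j<n | there e∈ = there (∈-++⁺ˡ e∈)
    end-in-interval suffix k≤j j<n | there e∈ = there (∈-++⁺ʳ _ e∈)

    below-τ⊆ : ∀ {z} → z ∈ below σ τ → z ∈ interval
    below-τ⊆ {z} z∈ = classify (∈-below⁻ σ τ z∈)
      where
      classify : IsFactor z τ × σ ≼ z × z ≢ τ → z ∈ interval
      classify ((a , j , fits , z≡W) , σ≼z , z≢τ) =
        subst (_∈ interval) (sym z≡end) (end-in-interval d (proj₂ at-end) j<n)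
        where
        at-end = factor-is-end fits (subst (σ ≼_) z≡W σ≼z)
        d = proj₁ (proj₁ at-end)
        z≡end : z ≡ end d j
        z≡end = trans z≡W (cong (λ b → W b j) (proj₂ (proj₁ at-end)))
        j<n : j < n
        j<n = ≤∧≢⇒< (m+n≤o⇒n≤o a fits)
                    (λ j≡n → z≢τ (trans z≡end (trans (cong (end d) j≡n) (end-n d))))

    chain-in-below : ∀ d {z} → z ∈ applyUpTo (chain d) N → z ∈ below σ τ
    chain-in-below d z∈ with ∈-applyUpTo⁻ (chain d) z∈
    ... | i , i<N , refl = subst (λ y → chain d i ∈ below σ y) (end-n d)
          (end-in-below d (m≤n⇒m≤1+n (m≤m+n k i)) (chain-proper i<N) ≤-refl)

    below-τ⊇ : ∀ {z} → z ∈ interval → z ∈ below σ τ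
    below-τ⊇ (here refl) =
      subst₂ (λ x y → x ∈ below σ y) (end-k prefix) (end-n prefix)
             (end-in-below prefix ≤-refl k<n ≤-refl)
    below-τ⊇ (there z∈) with ∈-++⁻ prefixes z∈
    ... | inj₁ z∈p = chain-in-below prefix z∈p
    ... | inj₂ z∈s = chain-in-below suffix z∈s

    μ-τ : μ σ τ ≡ ⁺ 1
    μ-τ = begin
      μ′ (suc n) σ τ
        ≡⟨ μ′-recurrence n σ τ interval σ≢τ σ≼τ interval-unique below-τ⊆ below-τ⊇ ⟩
      - (μ′ n σ σ +ℤ sumℤ (map (μ′ n σ) (prefixes ++ suffixes)))
        ≡⟨ cong (λ s → - (μ′ n σ σ +ℤ s))
             (trans (cong sumℤ (map-++ (μ′ n σ) prefixes suffixes))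
                    (sumℤ-++ (map (μ′ n σ) prefixes) (map (μ′ n σ) suffixes))) ⟩
      - (μ′ n σ σ +ℤ (sumℤ (map (μ′ n σ) prefixes) +ℤ sumℤ (map (μ′ n σ) suffixes)))
        ≡⟨ cong₂ (λ a b → - (a +ℤ b)) (μ′-refl σ (<-≤-trans z<s k<n))
             (cong₂ _+ℤ_ (chain-sum prefix) (chain-sum suffix)) ⟩
      - (⁺ 1 +ℤ (chainSum N +ℤ chainSum N))
        ≡⟨ cong (λ s → - (⁺ 1 +ℤ (s +ℤ s))) (chainSum-pos (m<n⇒0<n∸m 1+k<n)) ⟩
      ⁺ 1 ∎
      where
      σ≢τ : σ ≢ τ
      σ≢τ = ≢-by-length (<⇒≢ k<n)
      σ≼τ : σ ≼ τ
      σ≼τ = subst (σ ≼_) (end-n prefix) (σ≼end prefix (<⇒≤ k<n) ≤-refl)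
      chain-sum : ∀ d → sumℤ (map (μ′ n σ) (applyUpTo (chain d) N)) ≡ chainSum N
      chain-sum d = sum-chainValues (μ′ n σ) (chain d) N
        (λ i<N → ChainAt.μ-chain d n i<N (chain-proper i<N))
      1+k<n : suc k < n
      1+k<n = ≤-trans (n≤1+n (2 + k)) 3+k≤n
      chainSum-pos : ∀ {m} → 0 < m → chainSum m ≡ -[1+ 0 ]
      chainSum-pos {suc _} _ = refl

lemma3p2 : (σ τ : List ℕ) → IsPerm σ → IsPerm τ →
    2 ≤ occ σ τ → 3 + length σ ≤ length τ →
    ¬ InInterval σ τ (interior τ) →
    μ σ τ ≡ ⁺ 1
lemma3p2 σ τ _ τ-perm 2≤occ 3+k≤n ∂τ∂∉
  with i , j , σ-at-i , σ-at-j , i≢j ← two-occurrences σ τ 2≤occ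
  with σ-at-start , σ-at-end ← Ends.both-ends σ τ 3+k≤n ∂τ∂∉ σ-at-i σ-at-j i≢j
  = Ends.AtBothEnds.μ-τ σ τ 3+k≤n ∂τ∂∉ (st-perm τ τ-perm) σ-at-start σ-at-end
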